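{- Let $G$ be a finite connected graph with at least two vertices and vertex set $V$, and consider the metric space $(V,dist)$ where $dist$ is the shortest-path distance. Then every closure line $C(xy)$ ($x\ne y$ in $V$) consists of exactly two points of $V$ or of all points of $V$.
   Context: In a metric space $(V,dist)$, a point $v$ lies between points $u$ and $w$ if $u,v,w$ are pairwise distinct and $dist(u,v)+dist(v,w)=dist(u,w)$. For distinct points $x,y$, the line $L(xy)$ is the set consisting of $x$, $y$, and all points $z$ such that one of the three points $x,y,z$ lies between the other two. The closure line $C(xy)$ is the smallest superset $S$ of $L(xy)$ such that for all distinct $u,v\in S$ we have $L(uv)\subseteq S$. -}

module Defs where

open import Data.Nat using (ℕ; zero; suc; _+_; _≤_)
open import Data.Fin using (Fin)
open import Data.Product using (Σ; ∃; _×_; _,_)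
open import Data.Sum using (_⊎_)
open import Relation.Nullary using (¬_; Dec)
open import Relation.Binary.PropositionalEquality using (_≡_; _≢_)

record Graph (n : ℕ) : Set₁ where
  field
    Adj      : Fin n → Fin n → Set
    adj?     : ∀ u v → Dec (Adj u v)
    adj-sym  : ∀ {u v} → Adj u v → Adj v u
    adj-irr  : ∀ {u} → ¬ Adj u u

module _ {n : ℕ} (G : Graph n) where
  open Graph G

  data Walk : Fin n → Fin n → ℕ → Set where
    nil  : ∀ {u} → Walk u u 0
    cons : ∀ {u w v k} → Adj u w → Walk w v k → Walk u v (suc k)

  Connected : Set
  Connected = ∀ u v → ∃ λ k → Walk u v k

  IsDist : Fin n → Fin n → ℕ → Set
  IsDist u v d = Walk u v d × (∀ k → Walk u v k → d ≤ k)

  Between : Fin n → Fin n → Fin n → Set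
  Between u v w =
    u ≢ v × v ≢ w × u ≢ w ×
    Σ ℕ λ a → Σ ℕ λ b → Σ ℕ λ c →
      IsDist u v a × IsDist v w b × IsDist u w c × a + b ≡ c

  Line : Fin n → Fin n → Fin n → Set
  Line x y z =
    z ≡ x ⊎ z ≡ y ⊎ Between y x z ⊎ Between x y z ⊎ Between x z y

  data Closure (x y : Fin n) : Fin n → Set where
    base : ∀ {z} → Line x y z → Closure x y z
    step : ∀ {u v z} → Closure x y u → Closure x y v → u ≢ v →
           Line u v z → Closure x y z

-- Call an induced path a – m – b (so a ≁ b) an induced P₃; its middle vertex
-- lies between its ends.  If a line-closed set S contains an induced P₃, it
-- contains every neighbour t of each of its vertices: t lies beyond the middle
-- of an induced P₃ in S, or between its ends, and becomes a vertex of a new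
-- induced P₃ in S.  So in a connected graph S is everything.  If x ≁ y, the
-- first three vertices of a geodesic from x to y form an induced P₃ in L(xy);
-- if x ∼ y and some w is adjacent to exactly one of them, w, x, y do.
-- Otherwise x and y are adjacent twins, no point lies beyond either of them
-- or between them, and C(xy) = {x, y}.
module Submission where

open import Defs
open import Data.Nat using (ℕ; zero; suc; _+_; _≤_; _<_; z≤n; s≤s)
open import Data.Nat.Properties
  using (≤-trans; ≤-pred; n≤1+n; ≮⇒≥; m+n≮n; n≮n; n≮0; m+n≤o⇒n≤o;
         +-cancelˡ-≤; +-cancelʳ-≤; anyUpTo?)
open import Data.Nat.Induction using (<-rec)
open import Data.Fin using (Fin; _≟_)
open import Data.Fin.Properties using (any?)
open import Data.Sum using (_⊎_; inj₁; inj₂; swap)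
open import Data.Product using (∃; ∃₂; _×_; _,_; proj₂)
import Data.Product as Product
open import Data.Empty using (⊥; ⊥-elim)
open import Relation.Nullary using (¬_; Dec; yes; no)
open import Relation.Nullary.Decidable using (_×-dec_; _⊎-dec_; ¬?)
open import Relation.Binary.PropositionalEquality using (_≡_; _≢_; refl; ≢-sym)

least-witness : {P : ℕ → Set} → (∀ k → Dec (P k)) →
                ∀ {k} → P k → ∃ λ d → P d × (∀ j → P j → d ≤ j)
least-witness {P} P? {k} = <-rec Goal search k
  where
  Goal : ℕ → Set
  Goal k = P k → ∃ λ d → P d × (∀ j → P j → d ≤ j)

  search : ∀ k → (∀ {j} → j < k → Goal j) → Goal k
  search k rec Pk with anyUpTo? P? k
  ... | yes (j , j<k , Pj) = rec j<k Pj
  ... | no none            = k , Pk , λ j Pj → ≮⇒≥ (λ j<k → none (j , j<k , Pj))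

module _ {n : ℕ} (G : Graph n) where
  open Graph G

  adj⇒≢ : ∀ {u v} → Adj u v → u ≢ v
  adj⇒≢ uv refl = adj-irr uv

  _++ʷ_ : ∀ {u v w a b} → Walk G u v a → Walk G v w b → Walk G u w (a + b)
  nil       ++ʷ q = q
  cons uw p ++ʷ q = cons uw (p ++ʷ q)

  walk? : ∀ u v k → Dec (Walk G u v k)
  walk? u v zero with u ≟ v
  ... | yes refl = yes nil
  ... | no u≢v   = no λ { nil → u≢v refl }
  walk? u v (suc k) with any? (λ w → adj? u w ×-dec walk? w v k)
  ... | yes (w , uw , p) = yes (cons uw p)
  ... | no none          = no λ { (cons uw p) → none (_ , uw , p) }

  shortest : ∀ {u v k} → Walk G u v k → ∃ (IsDist G u v)
  shortest {u} {v} = least-witness (walk? u v)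

  adj⇒dist1 : ∀ {u v} → Adj u v → IsDist G u v 1
  adj⇒dist1 uv = cons uv nil , λ { zero nil → ⊥-elim (adj-irr uv) ; (suc k) _ → s≤s z≤n }

  geodesic-prefix : ∀ {u v w a b} → IsDist G u w (a + b) →
                    Walk G u v a → Walk G v w b → IsDist G u v a
  geodesic-prefix {a = a} {b} (_ , minimal) p q =
    p , λ j r → +-cancelʳ-≤ b a j (minimal (j + b) (r ++ʷ q))

  geodesic-suffix : ∀ {u v w a b} → IsDist G u w (a + b) →
                    Walk G u v a → Walk G v w b → IsDist G v w b
  geodesic-suffix {a = a} {b} (_ , minimal) p q =
    q , λ j r → +-cancelˡ-≤ a b j (minimal (a + j) (p ++ʷ r))

  geodesic⇒between : ∀ {u v w a b} → u ≢ v → v ≢ w → u ≢ w → IsDist G u w (a + b) →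
                     Walk G u v a → Walk G v w b → Between G u v w
  geodesic⇒between {a = a} {b} u≢v v≢w u≢w d p q =
    u≢v , v≢w , u≢w , a , b , a + b ,
    geodesic-prefix d p q , geodesic-suffix d p q , d , refl

  line-x : ∀ {x y} → Line G x y x
  line-x = inj₁ refl

  line-y : ∀ {x y} → Line G x y y
  line-y = inj₂ (inj₁ refl)

  line-beyond-x : ∀ {x y z} → Between G y x z → Line G x y z
  line-beyond-x b = inj₂ (inj₂ (inj₁ b))

  line-beyond-y : ∀ {x y z} → Between G x y z → Line G x y z
  line-beyond-y b = inj₂ (inj₂ (inj₂ (inj₁ b)))

  line-between : ∀ {x y z} → Between G x z y → Line G x y z
  line-between b = inj₂ (inj₂ (inj₂ (inj₂ b)))

  InducedP₃ : Fin n → Fin n → Fin n → Set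
  InducedP₃ a m b = Adj a m × Adj m b × a ≢ b × ¬ Adj a b

  inducedP₃? : ∀ a m b → Dec (InducedP₃ a m b)
  inducedP₃? a m b = adj? a m ×-dec adj? m b ×-dec ¬? (a ≟ b) ×-dec ¬? (adj? a b)

  inducedP₃-reverse : ∀ {a m b} → InducedP₃ a m b → InducedP₃ b m a
  inducedP₃-reverse (am , mb , a≢b , a≁b) =
    adj-sym mb , adj-sym am , ≢-sym a≢b , (λ ba → a≁b (adj-sym ba))

  inducedP₃⇒between : ∀ {a m b} → InducedP₃ a m b → Between G a m b
  inducedP₃⇒between (am , mb , a≢b , a≁b) =
    adj⇒≢ am , adj⇒≢ mb , a≢b , 1 , 1 , 2 , adj⇒dist1 am , adj⇒dist1 mb , dist2 , refl
    where
    dist2 : IsDist G _ _ 2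
    dist2 = cons am (cons mb nil) , λ
      { zero nil                 → ⊥-elim (a≢b refl)
      ; (suc zero) (cons ab nil) → ⊥-elim (a≁b ab)
      ; (suc (suc k)) _          → s≤s (s≤s z≤n) }

  P₃In : (Fin n → Set) → Fin n → Fin n → Fin n → Set
  P₃In S a m b = S a × S m × S b × InducedP₃ a m b

  P₃In-reverse : ∀ {S a m b} → P₃In S a m b → P₃In S b m a
  P₃In-reverse (Sa , Sm , Sb , P) = Sb , Sm , Sa , inducedP₃-reverse P

  ContainsInducedP₃ : (Fin n → Set) → Set
  ContainsInducedP₃ S = ∃ λ a → ∃₂ λ m b → P₃In S a m b

  ContainsInducedP₃-map : ∀ {S T : Fin n → Set} → (∀ {z} → S z → T z) →
                          ContainsInducedP₃ S → ContainsInducedP₃ T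
  ContainsInducedP₃-map f (a , m , b , Sa , Sm , Sb , P) = a , m , b , f Sa , f Sm , f Sb , P

  LineClosed : (Fin n → Set) → Set
  LineClosed S = ∀ {u v z} → S u → S v → u ≢ v → Line G u v z → S z

  module _ {S : Fin n → Set} (closed : LineClosed S) where

    EndOfP₃In MidOfP₃In OnP₃In : Fin n → Set
    EndOfP₃In t = ∃₂ λ m b → P₃In S t m b
    MidOfP₃In t = ∃₂ λ a b → P₃In S a t b
    OnP₃In t    = EndOfP₃In t ⊎ MidOfP₃In t

    onP₃In⇒∈ : ∀ {t} → OnP₃In t → S t
    onP₃In⇒∈ (inj₁ (_ , _ , St , _)) = St
    onP₃In⇒∈ (inj₂ (_ , _ , _ , St , _)) = St

    step-beyond : ∀ {a m t} → S a → S m → Adj a m → Adj m t →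
                  t ≡ a ⊎ Adj a t ⊎ EndOfP₃In t
    step-beyond {a} {m} {t} Sa Sm am mt with t ≟ a | adj? a t
    ... | yes t≡a | _      = inj₁ t≡a
    ... | no _    | yes at = inj₂ (inj₁ at)
    ... | no t≢a  | no a≁t = inj₂ (inj₂ (m , a , St , Sm , Sa , inducedP₃-reverse P))
      where
      P : InducedP₃ a m t
      P = am , mt , ≢-sym t≢a , a≁t
      St : S t
      St = closed Sa Sm (adj⇒≢ am) (line-beyond-y (inducedP₃⇒between P))

    from-middle : ∀ {a m b t} → P₃In S a m b → Adj m t → OnP₃In t
    from-middle abm@(Sa , Sm , Sb , am , mb , a≢b , a≁b) mt
      with step-beyond Sa Sm am mt
    ... | inj₁ refl       = inj₁ (_ , _ , abm)
    ... | inj₂ (inj₂ end) = inj₁ end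
    ... | inj₂ (inj₁ at) with step-beyond Sb Sm (adj-sym mb) mt
    ...   | inj₁ refl       = inj₁ (_ , _ , P₃In-reverse abm)
    ...   | inj₂ (inj₂ end) = inj₁ end
    ...   | inj₂ (inj₁ bt)  = inj₂ (_ , _ , Sa , St , Sb , P)
      where
      P : InducedP₃ _ _ _
      P = at , adj-sym bt , a≢b , a≁b
      St : S _
      St = closed Sa Sb a≢b (line-between (inducedP₃⇒between P))

    from-end : ∀ {v m b t} → P₃In S v m b → Adj v t → OnP₃In t
    from-end vmb@(Sv , Sm , _ , vm , _) vt with step-beyond Sm Sv (adj-sym vm) vt
    ... | inj₁ refl       = inj₂ (_ , _ , vmb)
    ... | inj₂ (inj₁ mt)  = from-middle vmb mt
    ... | inj₂ (inj₂ end) = inj₁ end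

    onP₃In-walk : ∀ {v t k} → OnP₃In v → Walk G v t k → OnP₃In t
    onP₃In-walk on nil = on
    onP₃In-walk (inj₁ (_ , _ , vmb)) (cons vw p) = onP₃In-walk (from-end vmb vw) p
    onP₃In-walk (inj₂ (_ , _ , avb)) (cons vw p) = onP₃In-walk (from-middle avb vw) p

    containsInducedP₃⇒total : Connected G → ContainsInducedP₃ S → ∀ z → S z
    containsInducedP₃⇒total conn (a , m , b , amb) z =
      onP₃In⇒∈ (onP₃In-walk (inj₁ (m , b , amb)) (proj₂ (conn a z)))

  line-containsInducedP₃⇒closure-total : ∀ {x y} → Connected G →
    ContainsInducedP₃ (Line G x y) → ∀ z → Closure G x y z
  line-containsInducedP₃⇒closure-total conn P =
    containsInducedP₃⇒total step conn (ContainsInducedP₃-map base P)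

  nonadjacent⇒line-containsInducedP₃ : ∀ {x y d} → x ≢ y → ¬ Adj x y → IsDist G x y d →
                                        ContainsInducedP₃ (Line G x y)
  nonadjacent⇒line-containsInducedP₃ x≢y x≁y (nil , _) = ⊥-elim (x≢y refl)
  nonadjacent⇒line-containsInducedP₃ x≢y x≁y (cons xy nil , _) = ⊥-elim (x≁y xy)
  nonadjacent⇒line-containsInducedP₃ {x} {y} x≢y x≁y
    geodesic@(cons {w = a₁} xa₁ (cons {w = a₂} {k = e} a₁a₂ rest) , minimal) =
    x , a₁ , a₂ , line-x , a₁-on-line , a₂-on-line , xa₁ , a₁a₂ , x≢a₂ , x≁a₂
    where
    x≢a₂ : x ≢ a₂
    x≢a₂ refl = m+n≮n 1 e (minimal e rest)

    x≁a₂ : ¬ Adj x a₂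
    x≁a₂ xa₂ = n≮n (suc e) (minimal (suc e) (cons xa₂ rest))

    a₁-on-line : Line G x y a₁
    a₁-on-line = line-between (geodesic⇒between (adj⇒≢ xa₁) (λ { refl → x≁y xa₁ }) x≢y
                                 geodesic (cons xa₁ nil) (cons a₁a₂ rest))

    a₂-on-line : Line G x y a₂
    a₂-on-line with a₂ ≟ y
    ... | yes refl  = line-y
    ... | no a₂≢y = line-between (geodesic⇒between x≢a₂ a₂≢y x≢y
                                    geodesic (cons xa₁ (cons a₁a₂ nil)) rest)

  DominatedBy : Fin n → Fin n → Set
  DominatedBy x y = ∀ {w} → w ≢ y → Adj w x → Adj w y

  Twins : Fin n → Fin n → Set
  Twins x y = DominatedBy x y × DominatedBy y x

  dominatedBy-or-inducedP₃ : ∀ {x y} → Adj x y →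
                             DominatedBy x y ⊎ ∃ λ w → InducedP₃ w x y
  dominatedBy-or-inducedP₃ {x} {y} xy with any? (λ w → inducedP₃? w x y)
  ... | yes found = inj₂ found
  ... | no none   = inj₁ dominated
    where
    dominated : DominatedBy x y
    dominated {w} w≢y wx with adj? w y
    ... | yes wy = wy
    ... | no w≁y = ⊥-elim (none (w , wx , xy , w≢y , w≁y))

  twins-or-line-containsInducedP₃ : ∀ {x y} → Adj x y → Twins x y ⊎ ContainsInducedP₃ (Line G x y)
  twins-or-line-containsInducedP₃ {x} {y} xy
    with dominatedBy-or-inducedP₃ xy | dominatedBy-or-inducedP₃ (adj-sym xy)
  ... | inj₁ x≼y | inj₁ y≼x = inj₁ (x≼y , y≼x)
  ... | inj₂ (w , wxy) | _ =
    inj₂ (y , x , w , line-y , line-x , line-beyond-x (inducedP₃⇒between yxw) , yxw)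
    where yxw = inducedP₃-reverse wxy
  ... | _ | inj₂ (w , wyx) =
    inj₂ (x , y , w , line-x , line-y , line-beyond-y (inducedP₃⇒between xyw) , xyw)
    where xyw = inducedP₃-reverse wyx

  -- Redirecting the first step of a geodesic from x to z through y gives d(y,z) ≤ d(x,z).
  dominatedBy⇒¬between : ∀ {x y z} → Adj x y → DominatedBy x y → ¬ Between G y x z
  dominatedBy⇒¬between _ _ (y≢x , _ , _ , _ , _ , _ , (nil , _) , _) = y≢x refl
  dominatedBy⇒¬between {x} {y} {z} xy x≼y
    (_ , x≢z , _ , _ , b , _ , (cons {k = a} _ _ , _) , (xz , _) , (_ , minimal) , refl) =
    redirect xz
    where
    redirect : Walk G x z b → ⊥
    redirect nil = x≢z refl
    redirect (cons {w = w} xw p) with w ≟ y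
    ... | yes refl = m+n≮n a b (≤-trans (minimal _ p) (n≤1+n _))
    ... | no w≢y   = m+n≮n a b (minimal _ (cons (adj-sym (x≼y w≢y (adj-sym xw))) p))

  adjacent⇒¬between : ∀ {x y z} → Adj x y → ¬ Between G x z y
  adjacent⇒¬between _ (x≢z , _ , _ , _ , _ , _ , (nil , _) , _) = x≢z refl
  adjacent⇒¬between _ (_ , z≢y , _ , _ , _ , _ , _ , (nil , _) , _) = z≢y refl
  adjacent⇒¬between xy
    (_ , _ , _ , suc a , suc b , _ , (cons _ _ , _) , (cons _ _ , _) , (_ , minimal) , refl) =
    n≮0 (m+n≤o⇒n≤o a (≤-pred (minimal 1 (cons xy nil))))

  twins⇒line⊆ : ∀ {x y z} → Adj x y → Twins x y → Line G x y z → z ≡ x ⊎ z ≡ y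
  twins⇒line⊆ _ _ (inj₁ z≡x) = inj₁ z≡x
  twins⇒line⊆ _ _ (inj₂ (inj₁ z≡y)) = inj₂ z≡y
  twins⇒line⊆ xy (x≼y , _) (inj₂ (inj₂ (inj₁ yxz))) = ⊥-elim (dominatedBy⇒¬between xy x≼y yxz)
  twins⇒line⊆ xy (_ , y≼x) (inj₂ (inj₂ (inj₂ (inj₁ xyz)))) =
    ⊥-elim (dominatedBy⇒¬between (adj-sym xy) y≼x xyz)
  twins⇒line⊆ xy _ (inj₂ (inj₂ (inj₂ (inj₂ xzy)))) = ⊥-elim (adjacent⇒¬between xy xzy)

  twins⇒closure⊆ : ∀ {x y z} → Adj x y → Twins x y → Closure G x y z → z ≡ x ⊎ z ≡ y
  twins⇒closure⊆ xy twins (base l) = twins⇒line⊆ xy twins l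
  twins⇒closure⊆ xy twins (step cu cv u≢v l)
    with twins⇒closure⊆ xy twins cu | twins⇒closure⊆ xy twins cv
  ... | inj₁ refl | inj₁ refl = ⊥-elim (u≢v refl)
  ... | inj₁ refl | inj₂ refl = twins⇒line⊆ xy twins l
  ... | inj₂ refl | inj₁ refl = swap (twins⇒line⊆ (adj-sym xy) (Product.swap twins) l)
  ... | inj₂ refl | inj₂ refl = ⊥-elim (u≢v refl)

mainTheorem2 : (n : ℕ) → 2 ≤ n → (G : Graph n) → Connected G →
    (x y : Fin n) → x ≢ y →
    (∀ z → Closure G x y z → z ≡ x ⊎ z ≡ y) ⊎ (∀ z → Closure G x y z)
mainTheorem2 n _ G conn x y x≢y with Graph.adj? G x y
... | no x≁y = inj₂ (line-containsInducedP₃⇒closure-total G conn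
                      (nonadjacent⇒line-containsInducedP₃ G x≢y x≁y
                        (proj₂ (shortest G (proj₂ (conn x y))))))
... | yes xy with twins-or-line-containsInducedP₃ G xy
...   | inj₁ twins = inj₁ (λ z → twins⇒closure⊆ G xy twins)
...   | inj₂ P     = inj₂ (line-containsInducedP₃⇒closure-total G conn P)
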